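{- Define integer sequences $(a_n),(b_n),(c_n),(d_n)$, $n\ge 0$, by the formal power series expansions \[ \frac{1-3x+9x^2}{1-2x-2x^2+x^3}=\sum_{n\ge0}a_nx^n,\quad \frac{2+6x-12x^2}{1-2x-2x^2+x^3}=\sum_{n\ge0}b_nx^n, \] \[ \frac{2+8x-10x^2}{1-2x-2x^2+x^3}=\sum_{n\ge0}c_nx^n,\quad \frac{1-11x+x^2}{1-2x-2x^2+x^3}=\sum_{n\ge0}d_nx^n. \] Then for all $n\ge 0$, $a_n^3+b_n^3=c_n^3+d_n^3$. -}

module Defs where

open import Data.Nat using (ℕ; zero; suc)
open import Data.Integer using (ℤ; +_; -_; _+_; _*_; _-_)
open import Data.List using (List; []; _∷_)

-- A polynomial with integer coefficients, as its coefficient list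
-- [p₀, p₁, p₂, …] (p₀ is the constant term).
Poly : Set
Poly = List ℤ

coeff : Poly → ℕ → ℤ
coeff []       _       = + 0
coeff (p ∷ ps) zero    = p
coeff (p ∷ ps) (suc n) = coeff ps n

-- Coefficients of the formal power series P(x)/Q(x) where
-- Q(x) = 1 - q₁ x - q₂ x² - … is given by its *tail* (q₁, q₂, …) with the
-- constant term 1 built in; the series s is the unique one with Q·s = P,
-- i.e. s_n = p_n + Σ_{k≥1} q_k s_{n-k}.
-- Here we specialise to the denominator of the paper,
--   1 - 2x - 2x² + x³ ,
-- so s_n = p_n + 2 s_{n-1} + 2 s_{n-2} - s_{n-3}  (with s_m = 0 for m < 0).
private
  record Triple : Set where
    constructor ⟨_,_,_⟩
    field t₀ t₁ t₂ : ℤ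

  step : Poly → ℕ → Triple
  step P zero    = ⟨ coeff P 0 , + 0 , + 0 ⟩
  step P (suc n) with step P n
  ... | ⟨ s₀ , s₁ , s₂ ⟩ =
        ⟨ coeff P (suc n) + (+ 2) * s₀ + (+ 2) * s₁ - s₂ , s₀ , s₁ ⟩

seriesCoeff : Poly → ℕ → ℤ
seriesCoeff P n = Triple.t₀ (step P n)

denom : Poly
denom = + 1 ∷ - (+ 2) ∷ - (+ 2) ∷ + 1 ∷ []

a b c d : ℕ → ℤ
a = seriesCoeff (+ 1 ∷ - (+ 3) ∷ + 9 ∷ [])
b = seriesCoeff (+ 2 ∷ + 6 ∷ - (+ 12) ∷ [])
c = seriesCoeff (+ 2 ∷ + 8 ∷ - (+ 10) ∷ [])
d = seriesCoeff (+ 1 ∷ - (+ 11) ∷ + 1 ∷ [])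

cube : ℤ → ℤ
cube x = x * x * x

-- The denominator factors as 1 - 2x - 2x² + x³ = (1 + x)(1 - 3x + x²), so each
-- of 5aₙ, 5bₙ, 5cₙ, 5dₙ is an integer combination A yₙ + B pₙ + C qₙ of
-- yₙ = (-1)ⁿ, pₙ = F₂ₙ and qₙ = F₂ₙ₊₂ (bisected Fibonacci numbers).  As a
-- polynomial in y, p, q, the difference of the two sums of cubes is a
-- multiple of y² - (p² - 3pq + q²), and this vanishes along the sequence
-- because yₙ² = 1 and, by a Cassini-type identity, pₙ² - 3pₙqₙ + qₙ² = 1.
module Submission where

open import Defs
open import Data.Nat using (ℕ; zero; suc)
open import Data.Integer using (ℤ; +_; -_; _+_; _*_; _-_)
open import Data.Integer.Properties using (+-identityˡ; *-cancelˡ-≡)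
open import Data.Integer.Tactic.RingSolver using (solve-∀)
open import Data.Product using (_×_; _,_; proj₁)
open import Relation.Binary.PropositionalEquality
  using (_≡_; refl; sym; trans; cong; cong₂; module ≡-Reasoning)

open ≡-Reasoning

ThirdOrder : (ℤ → ℤ → ℤ → ℤ) → (ℕ → ℤ) → Set
ThirdOrder F f = ∀ n → f (suc (suc (suc n))) ≡ F (f (suc (suc n))) (f (suc n)) (f n)

thirdOrder-unique : ∀ {F f g} → ThirdOrder F f → ThirdOrder F g →
                    f 0 ≡ g 0 → f 1 ≡ g 1 → f 2 ≡ g 2 → ∀ n → f n ≡ g n
thirdOrder-unique {F} {f} {g} rf rg e₀ e₁ e₂ n = proj₁ (agree n)
  where
  agree : ∀ n → f n ≡ g n × f (suc n) ≡ g (suc n) × f (suc (suc n)) ≡ g (suc (suc n))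
  agree zero    = e₀ , e₁ , e₂
  agree (suc n) with agree n
  ... | h₀ , h₁ , h₂ = h₁ , h₂ , (begin
    f (suc (suc (suc n)))                  ≡⟨ rf n ⟩
    F (f (suc (suc n))) (f (suc n)) (f n)  ≡⟨ cong₂ (λ u v → F u v (f n)) h₂ h₁ ⟩
    F (g (suc (suc n))) (g (suc n)) (f n)  ≡⟨ cong (F (g (suc (suc n))) (g (suc n))) h₀ ⟩
    F (g (suc (suc n))) (g (suc n)) (g n)  ≡⟨ rg n ⟨
    g (suc (suc (suc n)))                  ∎)

denomStep : ℤ → ℤ → ℤ → ℤ
denomStep u v w = + 2 * u + + 2 * v - w

Recurrent : (ℕ → ℤ) → Set
Recurrent = ThirdOrder denomStep

seriesCoeff-recurrent : ∀ P → (∀ n → coeff P (suc (suc (suc n))) ≡ + 0) → Recurrent (seriesCoeff P)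
seriesCoeff-recurrent P vanish n = begin
  coeff P (suc (suc (suc n))) + + 2 * s (suc (suc n)) + + 2 * s (suc n) - s n
    ≡⟨ cong (λ c → c + + 2 * s (suc (suc n)) + + 2 * s (suc n) - s n) (vanish n) ⟩
  + 0 + + 2 * s (suc (suc n)) + + 2 * s (suc n) - s n
    ≡⟨ cong (λ u → u + + 2 * s (suc n) - s n) (+-identityˡ (+ 2 * s (suc (suc n)))) ⟩
  + 2 * s (suc (suc n)) + + 2 * s (suc n) - s n
    ∎
  where s = seriesCoeff P

recurrent-+ : ∀ {f g} → Recurrent f → Recurrent g → Recurrent (λ n → f n + g n)
recurrent-+ {f} {g} rf rg n = trans (cong₂ _+_ (rf n) (rg n))
  (linear (f (suc (suc n))) (f (suc n)) (f n) (g (suc (suc n))) (g (suc n)) (g n))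
  where
  linear : ∀ u v w u′ v′ w′ → (+ 2 * u + + 2 * v - w) + (+ 2 * u′ + + 2 * v′ - w′)
                              ≡ + 2 * (u + u′) + + 2 * (v + v′) - (w + w′)
  linear = solve-∀

recurrent-* : ∀ k {f} → Recurrent f → Recurrent (λ n → k * f n)
recurrent-* k {f} rf n = trans (cong (k *_) (rf n)) (linear k (f (suc (suc n))) (f (suc n)) (f n))
  where
  linear : ∀ k u v w → k * (+ 2 * u + + 2 * v - w) ≡ + 2 * (k * u) + + 2 * (k * v) - k * w
  linear = solve-∀

antiperiodic⇒recurrent : ∀ {f} → (∀ n → f (suc n) ≡ - f n) → Recurrent f
antiperiodic⇒recurrent {f} anti n
  rewrite anti (suc (suc n)) | anti (suc n) | anti n = identity (f n)
  where
  identity : ∀ y → - (- (- y)) ≡ + 2 * (- (- y)) + + 2 * (- y) - y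
  identity = solve-∀

lucas⇒recurrent : ∀ {f} → (∀ n → f (suc (suc n)) ≡ + 3 * f (suc n) - f n) → Recurrent f
lucas⇒recurrent {f} lucas n
  rewrite lucas (suc n) | lucas n = identity (f (suc n)) (f n)
  where
  identity : ∀ q p → + 3 * (+ 3 * q - p) - q ≡ + 2 * (+ 3 * q - p) + + 2 * q - p
  identity = solve-∀

alt : ℕ → ℤ
alt zero    = + 1
alt (suc n) = - alt n

evenFib : ℕ → ℤ
evenFib zero          = + 0
evenFib (suc zero)    = + 1
evenFib (suc (suc n)) = + 3 * evenFib (suc n) - evenFib n

alt-square : ∀ n → alt n * alt n ≡ + 1
alt-square zero    = refl
alt-square (suc n) = trans (neg-square (alt n)) (alt-square n)
  where
  neg-square : ∀ y → - y * - y ≡ y * y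
  neg-square = solve-∀

cassiniForm : ℤ → ℤ → ℤ
cassiniForm p q = p * p - + 3 * p * q + q * q

cassiniForm-evenFib : ∀ n → cassiniForm (evenFib n) (evenFib (suc n)) ≡ + 1
cassiniForm-evenFib zero    = refl
cassiniForm-evenFib (suc n) = trans (shift (evenFib n) (evenFib (suc n))) (cassiniForm-evenFib n)
  where
  shift : ∀ p q → q * q - + 3 * q * (+ 3 * q - p) + (+ 3 * q - p) * (+ 3 * q - p)
                  ≡ p * p - + 3 * p * q + q * q
  shift = solve-∀

closedForm : ℤ → ℤ → ℤ → ℕ → ℤ
closedForm A B C n = A * alt n + B * evenFib n + C * evenFib (suc n)

closedForm-recurrent : ∀ A B C → Recurrent (closedForm A B C)
closedForm-recurrent A B C =
  recurrent-+ {f = λ n → A * alt n + B * evenFib n}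
    (recurrent-+ {f = λ n → A * alt n}
      (recurrent-* A {alt} alt-recurrent)
      (recurrent-* B {evenFib} evenFib-recurrent))
    (recurrent-* C {λ n → evenFib (suc n)} evenFib-suc-recurrent)
  where
  alt-recurrent : Recurrent alt
  alt-recurrent = antiperiodic⇒recurrent {alt} λ _ → refl
  evenFib-recurrent : Recurrent evenFib
  evenFib-recurrent = lucas⇒recurrent {evenFib} λ _ → refl
  evenFib-suc-recurrent : Recurrent (λ n → evenFib (suc n))
  evenFib-suc-recurrent = lucas⇒recurrent {λ n → evenFib (suc n)} λ _ → refl

five*seriesCoeff≡closedForm :
  ∀ P A B C → (∀ n → coeff P (suc (suc (suc n))) ≡ + 0) →
  + 5 * seriesCoeff P 0 ≡ closedForm A B C 0 →
  + 5 * seriesCoeff P 1 ≡ closedForm A B C 1 →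
  + 5 * seriesCoeff P 2 ≡ closedForm A B C 2 →
  ∀ n → + 5 * seriesCoeff P n ≡ closedForm A B C n
five*seriesCoeff≡closedForm P A B C vanish =
  thirdOrder-unique {denomStep} (recurrent-* (+ 5) {seriesCoeff P} (seriesCoeff-recurrent P vanish))
                    (closedForm-recurrent A B C)

cube-sum-* : ∀ k u v → cube (k * u) + cube (k * v) ≡ cube k * (cube u + cube v)
cube-sum-* = expanded
  where
  expanded : ∀ k u v → (k * u) * (k * u) * (k * u) + (k * v) * (k * v) * (k * v)
                       ≡ k * k * k * (u * u * u + v * v * v)
  expanded = solve-∀

cube-sum-onQuadric :
  ∀ y p q → y * y ≡ cassiniForm p q →
  cube (+ 13 * y + + 32 * p + - + 8 * q) + cube (- + 16 * y + - + 44 * p + + 26 * q)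
    ≡ cube (- + 16 * y + - + 34 * p + + 26 * q) + cube (+ 13 * y + - + 8 * p + - + 8 * q)
cube-sum-onQuadric y p q onQuadric = begin
  cube u + cube v
    ≡⟨ factorisation y p q ⟩
  cube w + cube z + + 12600 * p * (y * y - cassiniForm p q)
    ≡⟨ cong (λ e → cube w + cube z + + 12600 * p * (e - cassiniForm p q)) onQuadric ⟩
  cube w + cube z + + 12600 * p * (cassiniForm p q - cassiniForm p q)
    ≡⟨ cancel (cube w + cube z) p (cassiniForm p q) ⟩
  cube w + cube z
    ∎
  where
  u = + 13 * y + + 32 * p + - + 8 * q
  v = - + 16 * y + - + 44 * p + + 26 * q
  w = - + 16 * y + - + 34 * p + + 26 * q
  z = + 13 * y + - + 8 * p + - + 8 * q
  factorisation : ∀ y p q →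
    let u = + 13 * y + + 32 * p + - + 8 * q
        v = - + 16 * y + - + 44 * p + + 26 * q
        w = - + 16 * y + - + 34 * p + + 26 * q
        z = + 13 * y + - + 8 * p + - + 8 * q
    in u * u * u + v * v * v
         ≡ w * w * w + z * z * z + + 12600 * p * (y * y - (p * p - + 3 * p * q + q * q))
  factorisation = solve-∀
  cancel : ∀ s p e → s + + 12600 * p * (e - e) ≡ s
  cancel = solve-∀

five*a≡closedForm : ∀ n → + 5 * a n ≡ closedForm (+ 13) (+ 32) (- + 8) n
five*a≡closedForm = five*seriesCoeff≡closedForm _ (+ 13) (+ 32) (- + 8) (λ _ → refl) refl refl refl

five*b≡closedForm : ∀ n → + 5 * b n ≡ closedForm (- + 16) (- + 44) (+ 26) n
five*b≡closedForm = five*seriesCoeff≡closedForm _ (- + 16) (- + 44) (+ 26) (λ _ → refl) refl refl refl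

five*c≡closedForm : ∀ n → + 5 * c n ≡ closedForm (- + 16) (- + 34) (+ 26) n
five*c≡closedForm = five*seriesCoeff≡closedForm _ (- + 16) (- + 34) (+ 26) (λ _ → refl) refl refl refl

five*d≡closedForm : ∀ n → + 5 * d n ≡ closedForm (+ 13) (- + 8) (- + 8) n
five*d≡closedForm = five*seriesCoeff≡closedForm _ (+ 13) (- + 8) (- + 8) (λ _ → refl) refl refl refl

theorem2p3 : (n : ℕ) → cube (a n) + cube (b n) ≡ cube (c n) + cube (d n)
theorem2p3 n = *-cancelˡ-≡ (+ 125) _ _ (begin
  + 125 * (cube (a n) + cube (b n))
    ≡⟨ cube-sum-* (+ 5) (a n) (b n) ⟨
  cube (+ 5 * a n) + cube (+ 5 * b n)
    ≡⟨ cong₂ (λ u v → cube u + cube v) (five*a≡closedForm n) (five*b≡closedForm n) ⟩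
  cube (closedForm (+ 13) (+ 32) (- + 8) n) + cube (closedForm (- + 16) (- + 44) (+ 26) n)
    ≡⟨ cube-sum-onQuadric (alt n) (evenFib n) (evenFib (suc n)) onQuadric ⟩
  cube (closedForm (- + 16) (- + 34) (+ 26) n) + cube (closedForm (+ 13) (- + 8) (- + 8) n)
    ≡⟨ cong₂ (λ u v → cube u + cube v) (five*c≡closedForm n) (five*d≡closedForm n) ⟨
  cube (+ 5 * c n) + cube (+ 5 * d n)
    ≡⟨ cube-sum-* (+ 5) (c n) (d n) ⟩
  + 125 * (cube (c n) + cube (d n))
    ∎)
  where
  onQuadric : alt n * alt n ≡ cassiniForm (evenFib n) (evenFib (suc n))
  onQuadric = trans (alt-square n) (sym (cassiniForm-evenFib n))
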